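{- Let $\langle A\rangle$ be a GCNS numerical semigroup and let $p$ be a positive divisor of $a$ with $p\neq a$. Suppose $X(a-p)=(x_1,\ldots,x_k)$ is the greedy presentation of $a-p$ (so $x_k=\lfloor \frac{a-p}{b_k}\rfloor$). If $ua+d+k-2\geq \sum_{i=1}^{k-1}s_i$, $a+pd\geq 0$, and $s_i<u+1$ for all $1\leq i\leq k-1$, then $$F\left(\frac{\langle A\rangle}{p}\right)=\sum_{i=1}^k x_i\cdot\frac{a}{p}+\left(\frac{a}{p}-1\right)(ua+d)-\frac{a}{p}.$$ In particular, if $d>0$, it suffices to assume $ua+d+k-2\geq\sum_{i=1}^{k-1}s_i$ and $s_i\leq u+1$ for $1\leq i\leq k-1$, and the formula remains valid.
   Context: A GCNS numerical semigroup is $\langle A\rangle$ with $A=(a,h_1a+db_1,\ldots,h_ka+db_k)$, where $a,k\geq 2$, $d\in\mathbb{Z}\setminus\{0\}$, $\gcd(a,d)=1$, $b_1=1$, $b_{i+1}=s_ib_i+1$ with $1\leq s_1\leq s_2\leq\cdots\leq s_{k-1}$, $h_i=ub_i+1$ with $u\in\mathbb{Z}^+$, and additionally $h_ia+db_i>1$ for all $i$ when $d<0$. For $p\in\mathbb{Z}^+$, $\frac{\langle A\rangle}{p}=\{x\in\mathbb{N}\mid px\in\langle A\rangle\}$, and $F(S)$ denotes the Frobenius number (largest integer not in $S$). The greedy presentation $X(M)=(x_1,\ldots,x_k)$ of $M\in\mathbb{N}$ is the unique solution in $\mathbb{N}^k$ of $\sum_i b_ix_i=M$ with $x_k=\lfloor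 M/b_k\rfloor$, $x_i\in\{0,1,\ldots,s_i\}$ for $1\leq i\leq k-1$, and such that if $x_i=s_i$ for some $2\leq i\leq k-1$ then $x_1=\cdots=x_{i-1}=0$. -}

module Defs where

open import Data.Nat as ℕ using (ℕ; zero; suc)
import Data.Nat.Properties as ℕ
open import Data.Nat.GCD using (gcd)
open import Data.Integer as ℤ using (ℤ; +_)
open import Data.Product using (Σ; _×_; ∃)
open import Relation.Binary.PropositionalEquality using (_≡_)
open import Relation.Nullary using (¬_)

-- b-sequence, indexed from 1: b 1 = 1, b (i+1) = s i * b i + 1.
-- (The value at index 0 is a dummy and never used.)
bseq : (ℕ → ℕ) → ℕ → ℕ
bseq s zero = 1
bseq s (suc zero) = 1
bseq s (suc (suc i)) = s (suc i) ℕ.* bseq s (suc i) ℕ.+ 1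

bseq-nonZero : ∀ s i → ℕ.NonZero (bseq s i)
bseq-nonZero s zero = _
bseq-nonZero s (suc zero) = _
bseq-nonZero s (suc (suc i)) rewrite ℕ.+-comm (s (suc i) ℕ.* bseq s (suc i)) 1 = _

hseq : ℕ → (ℕ → ℕ) → ℕ → ℕ
hseq u s i = u ℕ.* bseq s i ℕ.+ 1

-- sums over the index range 1..n
sumℕ : ℕ → (ℕ → ℕ) → ℕ
sumℕ zero f = 0
sumℕ (suc n) f = sumℕ n f ℕ.+ f (suc n)

sumℤ : ℕ → (ℕ → ℤ) → ℤ
sumℤ zero f = + 0
sumℤ (suc n) f = sumℤ n f ℤ.+ f (suc n)

gen : (a u : ℕ) (d : ℤ) (s : ℕ → ℕ) → ℕ → ℤ
gen a u d s zero = + a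
gen a u d s (suc i) =
  + (hseq u s (suc i) ℕ.* a) ℤ.+ d ℤ.* + bseq s (suc i)

record IsGCNS (a k : ℕ) (d : ℤ) (u : ℕ) (s : ℕ → ℕ) : Set where
  field
    a≥2      : 2 ℕ.≤ a
    k≥2      : 2 ℕ.≤ k
    d≢0      : ¬ (d ≡ + 0)
    coprime  : gcd a ℤ.∣ d ∣ ≡ 1
    u≥1      : 1 ℕ.≤ u
    s₁≥1     : 1 ℕ.≤ s 1
    s-mono   : ∀ i → 1 ℕ.≤ i → suc i ℕ.≤ k ℕ.∸ 1 → s i ℕ.≤ s (suc i)
    d<0⇒gen>1 : d ℤ.< + 0 → ∀ i → 1 ℕ.≤ i → i ℕ.≤ k → + 1 ℤ.< gen a u d s i

InSG : (a k u : ℕ) (d : ℤ) (s : ℕ → ℕ) → ℤ → Set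
InSG a k u d s z =
  Σ (ℕ → ℕ) λ c → z ≡ + (c 0) ℤ.* gen a u d s 0 ℤ.+ sumℤ k (λ i → + (c i) ℤ.* gen a u d s i)

InQuot : (a k u : ℕ) (d : ℤ) (s : ℕ → ℕ) (p : ℕ) → ℤ → Set
InQuot a k u d s p z = Σ ℕ λ n → (z ≡ + n) × InSG a k u d s (+ p ℤ.* z)

IsFrobenius : (ℤ → Set) → ℤ → Set
IsFrobenius S f = (¬ S f) × (∀ z → f ℤ.< z → S z)

record IsGreedy (k : ℕ) (s : ℕ → ℕ) (M : ℕ) (x : ℕ → ℕ) : Set where
  field
    total   : sumℕ k (λ i → bseq s i ℕ.* x i) ≡ M
    last    : x k ≡ (M ℕ./ bseq s k) ⦃ bseq-nonZero s k ⦄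
    bounded : ∀ i → 1 ℕ.≤ i → i ℕ.≤ k ℕ.∸ 1 → x i ℕ.≤ s i
    greedy  : ∀ i → 2 ℕ.≤ i → i ℕ.≤ k ℕ.∸ 1 → x i ≡ s i →
                ∀ j → 1 ℕ.≤ j → j ℕ.< i → x j ≡ 0

{-# OPTIONS --safe #-}
-- With C = u a + d every generator h_i a + d b_i equals a + b_i C, so ⟨A⟩ consists of the
-- numbers m a + M C for which the amount M can be paid with at most m coins of values
-- b_1, …, b_k.  Since b_{i+1} = s_i b_i + 1 with s nondecreasing, the greedy algorithm pays
-- every amount with the fewest coins; on a − p it uses G = Σ x_i coins.
--
-- Write a = q p.  For F = (G − 1) q + (q − 1) C we have p F = (G − 1) a + (a − p) C.  Any
-- other representation m a + M C of p F has a ∣ (M − (a − p)) C, hence a ∣ M − (a − p) as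
-- gcd (a, C) = 1.  Then M = a − p needs G ≤ m coins, M < a − p fails as 0 < a − p − M < a,
-- and M > a − p forces m + C < G, against G ≤ C + x_k ≤ C + m (this is where
-- u a + d + k − 2 ≥ Σ s_i enters).  Conversely every N > F is r C + m q with r < q, so
-- p N = m a + (p r) C; raising p r to a − p lowers the greedy count by at most
-- (q − 1 − r) p (s_{k−1} − 1), and a (s_{k−1} − 1) ≤ C makes the surplus N − F cover this.
module Submission where

open import Defs
open import Data.Nat as ℕ
  using (ℕ; NonZero; zero; suc; _+_; _*_; _∸_; _≤_; _<_; z≤n; s≤s; _/_; _%_)
open import Data.Nat.Properties
open import Data.Nat.DivMod
open import Data.Nat.Divisibility using (_∣_; divides; m∣m*n; n∣m*n; ∣m+n∣m⇒∣n; ∣-trans; ∣⇒≤)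
open import Data.Nat.Coprimality using (Coprime; coprime-Bézout; coprime-divisor; gcd≡1⇒coprime)
open import Data.Nat.GCD using (gcd; module Bézout)
open import Data.Integer as ℤ using (ℤ; +_; -[1+_]; ∣_∣)
import Data.Integer.Properties as ℤ
import Data.Integer.Tactic.RingSolver as ℤ-Solver
open import Relation.Binary.Definitions using (tri<; tri≈; tri>)
open import Data.Product using (∃; ∃₂; _×_; _,_)
open import Data.Sum using (inj₁; inj₂)
open import Data.Empty using (⊥-elim)
open import Relation.Nullary using (yes; no; ¬_; contradiction)
open import Relation.Binary.PropositionalEquality
open import Data.Nat.Tactic.RingSolver using (solve-∀)

divMod-elim : ∀ B .{{_ : NonZero B}} (P : ℕ → Set) →
              (∀ t Q → t < B → P (t + Q * B)) → ∀ M → P M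
divMod-elim B P h M = subst P (sym (m≡m%n+[m/n]*n M B)) (h (M % B) (M / B) (m%n<n M B))

[t+Q*B]/B≡Q : ∀ {B} .{{_ : NonZero B}} {t} Q → t < B → (t + Q * B) / B ≡ Q
[t+Q*B]/B≡Q {B} {t} Q t<B = begin
  (t + Q * B) / B   ≡⟨ +-distrib-/-∣ʳ t (n∣m*n Q) ⟩
  t / B + Q * B / B ≡⟨ cong₂ _+_ (m<n⇒m/n≡0 t<B) (m*n/n≡m Q B) ⟩
  Q                 ∎
  where open ≡-Reasoning

[t+Q*B]%B≡t : ∀ {B} .{{_ : NonZero B}} {t} Q → t < B → (t + Q * B) % B ≡ t
[t+Q*B]%B≡t {B} {t} Q t<B = trans ([m+kn]%n≡m%n t Q B) (m<n⇒m%n≡m t<B)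

sumℕ-cong : ∀ j {f g : ℕ → ℕ} → (∀ i → 1 ≤ i → i ≤ j → f i ≡ g i) → sumℕ j f ≡ sumℕ j g
sumℕ-cong zero    f≗g = refl
sumℕ-cong (suc j) f≗g =
  cong₂ _+_ (sumℕ-cong j (λ i 1≤i i≤j → f≗g i 1≤i (m≤n⇒m≤1+n i≤j))) (f≗g (suc j) (s≤s z≤n) ≤-refl)

sumℕ-zero : ∀ j {f : ℕ → ℕ} → (∀ i → 1 ≤ i → i ≤ j → f i ≡ 0) → sumℕ j f ≡ 0
sumℕ-zero zero    f≗0 = refl
sumℕ-zero (suc j) f≗0 =
  cong₂ _+_ (sumℕ-zero j (λ i 1≤i i≤j → f≗0 i 1≤i (m≤n⇒m≤1+n i≤j))) (f≗0 (suc j) (s≤s z≤n) ≤-refl)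

sumℕ-*ʳ : ∀ j (f : ℕ → ℕ) q → sumℕ j (λ i → f i * q) ≡ sumℕ j f * q
sumℕ-*ʳ zero    f q = refl
sumℕ-*ʳ (suc j) f q =
  trans (cong (_+ f (suc j) * q) (sumℕ-*ʳ j f q)) (sym (*-distribʳ-+ q (sumℕ j f) (f (suc j))))

sumℤ-+ : ∀ j (f : ℕ → ℕ) → sumℤ j (λ i → + f i) ≡ + sumℕ j f
sumℤ-+ zero    f = refl
sumℤ-+ (suc j) f = cong (ℤ._+ + f (suc j)) (sumℤ-+ j f)

sumℕ≡0⇒≡0 : ∀ j {f : ℕ → ℕ} → sumℕ j f ≡ 0 → ∀ i → 1 ≤ i → i ≤ j → f i ≡ 0
sumℕ≡0⇒≡0 zero            _     i 1≤i i≤0   = ⊥-elim (1+n≰n (≤-trans 1≤i i≤0))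
sumℕ≡0⇒≡0 (suc j) {f} sum≡0 i 1≤i i≤1+j with m≤n⇒m<n∨m≡n i≤1+j
... | inj₁ i<1+j = sumℕ≡0⇒≡0 j (m+n≡0⇒m≡0 _ sum≡0) i 1≤i (ℕ.s≤s⁻¹ i<1+j)
... | inj₂ refl  = m+n≡0⇒n≡0 (sumℕ j f) sum≡0

update : (ℕ → ℕ) → ℕ → ℕ → ℕ → ℕ
update c n v i with i ℕ.≟ n
... | yes _ = v
... | no  _ = c i

update-same : ∀ c n v → update c n v n ≡ v
update-same c n v with n ℕ.≟ n
... | yes _   = refl
... | no  n≢n = ⊥-elim (n≢n refl)

update-other : ∀ c n v i → i ≢ n → update c n v i ≡ c i
update-other c n v i i≢n with i ℕ.≟ n
... | yes i≡n = ⊥-elim (i≢n i≡n)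
... | no  _   = refl

coprime⇒inverse : ∀ {q C} → 2 ≤ q → Coprime q C → ∃₂ λ X Y → X * C ≡ 1 + Y * q
coprime⇒inverse {q} {C} 2≤q coprime with coprime-Bézout coprime
... | Bézout.-+ x y 1+xq≡yC = y , x , sym 1+xq≡yC
... | Bézout.+- zero     y 1+yC≡0 = ⊥-elim (1+n≢0 1+yC≡0)
coprime⇒inverse {suc (suc q″)} {C} (s≤s (s≤s z≤n)) coprime | Bézout.+- (suc x′) y 1+yC≡xq =
  q′ * y , x′ + q″ * suc x′ , +-cancelʳ-≡ q′ _ _ (begin
    q′ * y * C + q′                       ≡⟨ distrib q′ y C ⟩
    q′ * (1 + y * C)                      ≡⟨ cong (q′ *_) 1+yC≡xq ⟩
    q′ * (suc x′ * suc q′)                ≡⟨ expand q″ x′ ⟩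
    1 + (x′ + q″ * suc x′) * suc q′ + q′  ∎)
  where
  open ≡-Reasoning
  q′ = suc q″
  distrib : ∀ q′ y C → q′ * y * C + q′ ≡ q′ * (1 + y * C)
  distrib = solve-∀
  expand : ∀ q″ x′ → suc q″ * (suc x′ * suc (suc q″)) ≡ 1 + (x′ + q″ * suc x′) * suc (suc q″) + suc q″
  expand = solve-∀

coprime⇒decomposition : ∀ {q₁ C} .{{_ : NonZero q₁}} → Coprime (suc q₁) C →
                        ∀ n → q₁ * C ≤ n → ∃₂ λ r m → r ≤ q₁ × n ≡ r * C + m * suc q₁
coprime⇒decomposition {q₁} {C} coprime n q₁C≤n with coprime⇒inverse (s≤s (ℕ.>-nonZero⁻¹ q₁)) coprime
... | X , Y , XC≡1+Yq = r , e * C ∸ n * Y , r≤q₁ , (begin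
  n                                   ≡⟨ m+[n∸m]≡n rC≤n ⟨
  r * C + (n ∸ r * C)                 ≡⟨ cong (_+_ (r * C)) (m+n∸n≡m _ (n * Y * q)) ⟨
  r * C + (n ∸ r * C + n * Y * q ∸ n * Y * q) ≡⟨ cong (λ v → r * C + (v ∸ n * Y * q)) rest ⟩
  r * C + (e * C * q ∸ n * Y * q)     ≡⟨ cong (_+_ (r * C)) (*-distribʳ-∸ q (e * C) (n * Y)) ⟨
  r * C + (e * C ∸ n * Y) * q         ∎)
  where
  open ≡-Reasoning
  q = suc q₁
  r = (n * X) % q
  e = (n * X) / q
  r≤q₁ : r ≤ q₁
  r≤q₁ = ℕ.s≤s⁻¹ (m%n<n (n * X) q)
  rC≤n : r * C ≤ n
  rC≤n = ≤-trans (*-monoˡ-≤ C r≤q₁) q₁C≤n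
  rest : n ∸ r * C + n * Y * q ≡ e * C * q
  rest = +-cancelˡ-≡ (r * C) _ _ (begin
    r * C + (n ∸ r * C + n * Y * q) ≡⟨ +-assoc (r * C) _ _ ⟨
    r * C + (n ∸ r * C) + n * Y * q ≡⟨ cong (_+ n * Y * q) (m+[n∸m]≡n rC≤n) ⟩
    n + n * Y * q                   ≡⟨ factor n Y q ⟩
    n * (1 + Y * q)                 ≡⟨ cong (n *_) XC≡1+Yq ⟨
    n * (X * C)                     ≡⟨ *-assoc n X C ⟨
    n * X * C                       ≡⟨ cong (_* C) (m≡m%n+[m/n]*n (n * X) q) ⟩
    (r + e * q) * C                 ≡⟨ expand r e q C ⟩
    r * C + e * C * q               ∎)
    where
    factor : ∀ n Y q → n + n * Y * q ≡ n * (1 + Y * q)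
    factor = solve-∀
    expand : ∀ r e q C → (r + e * q) * C ≡ r * C + e * C * q
    expand = solve-∀

module GreedyCoins (s : ℕ → ℕ) where

  b : ℕ → ℕ
  b = bseq s

  b-nonZero : ∀ i → NonZero (b i)
  b-nonZero = bseq-nonZero s

  -- The base case counts the remainder in ones; as b 1 = 1 it agrees with greedyCoins 1.
  greedyCoins : ℕ → ℕ → ℕ
  greedyCoins zero    r = r
  greedyCoins (suc j) r =
    (r / b (suc j)) ⦃ b-nonZero (suc j) ⦄ + greedyCoins j ((r % b (suc j)) ⦃ b-nonZero (suc j) ⦄)

  greedyCoins-step : ∀ j {t} y → t < b (suc j) →
                     greedyCoins (suc j) (t + y * b (suc j)) ≡ y + greedyCoins j t
  greedyCoins-step j y t<b = cong₂ _+_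
    ([t+Q*B]/B≡Q ⦃ b-nonZero (suc j) ⦄ y t<b)
    (cong (greedyCoins j) ([t+Q*B]%B≡t ⦃ b-nonZero (suc j) ⦄ y t<b))

  decompose : ∀ j (P : ℕ → Set) → (∀ t Q → t < b (suc j) → P (t + Q * b (suc j))) → ∀ M → P M
  decompose j = divMod-elim (b (suc j)) ⦃ b-nonZero (suc j) ⦄

  0<b : ∀ i → 0 < b i
  0<b i = ℕ.>-nonZero⁻¹ (b i) ⦃ b-nonZero i ⦄

  greedyCoins-zero : ∀ j → greedyCoins j 0 ≡ 0
  greedyCoins-zero zero    = refl
  greedyCoins-zero (suc j) = trans (greedyCoins-step j 0 (0<b (suc j))) (greedyCoins-zero j)

  greedyCoins-*b : ∀ j y → greedyCoins (suc j) (y * b (suc j)) ≡ y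
  greedyCoins-*b j y =
    trans (greedyCoins-step j y (0<b (suc j))) (trans (cong (_+_ y) (greedyCoins-zero j)) (+-identityʳ y))

  greedyCoins-one : ∀ r → greedyCoins 1 r ≡ r
  greedyCoins-one r = trans (cong (greedyCoins 1) (sym (*-identityʳ r))) (greedyCoins-*b 0 r)

  greedyCoins-+* : ∀ j r y → greedyCoins (suc j) (r + y * b (suc j)) ≡ y + greedyCoins (suc j) r
  greedyCoins-+* j r y = decompose j P step r
    where
    B = b (suc j)
    P : ℕ → Set
    P r = greedyCoins (suc j) (r + y * B) ≡ y + greedyCoins (suc j) r
    step : ∀ t Q → t < B → P (t + Q * B)
    step t Q t<B = begin
      greedyCoins (suc j) (t + Q * B + y * B) ≡⟨ cong (greedyCoins (suc j)) (shift t Q y B) ⟩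
      greedyCoins (suc j) (t + (Q + y) * B)   ≡⟨ greedyCoins-step j (Q + y) t<B ⟩
      Q + y + greedyCoins j t                 ≡⟨ cong (_+ greedyCoins j t) (+-comm Q y) ⟩
      y + Q + greedyCoins j t                 ≡⟨ +-assoc y Q _ ⟩
      y + (Q + greedyCoins j t)               ≡⟨ cong (_+_ y) (greedyCoins-step j Q t<B) ⟨
      y + greedyCoins (suc j) (t + Q * B)     ∎
      where
      open ≡-Reasoning
      shift : ∀ t Q y B → t + Q * B + y * B ≡ t + (Q + y) * B
      shift = solve-∀

  Attained : ℕ → ℕ → Set
  Attained j r = ∃ λ c → sumℕ j (λ i → b i * c i) ≡ r × sumℕ j c ≡ greedyCoins j r

  greedyCoins-attained : ∀ j → 1 ≤ j → ∀ r → Attained j r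
  greedyCoins-attained (suc zero)    _ r = (λ _ → r) , +-identityʳ r , sym (greedyCoins-one r)
  greedyCoins-attained (suc (suc j)) _ =
    decompose (suc j) (Attained n) (extend (greedyCoins-attained (suc j) (s≤s z≤n)))
    where
    n = suc (suc j)
    extend : (∀ r → Attained (suc j) r) → ∀ t Q → t < b n → Attained n (t + Q * b n)
    extend attained t Q t<b with attained t
    ... | c , value , count = update c n Q , value′ , count′
      where
      below : ∀ i → 1 ≤ i → i ≤ suc j → update c n Q i ≡ c i
      below i _ i≤j = update-other c n Q i (λ { refl → 1+n≰n i≤j })
      value′ : sumℕ (suc j) (λ i → b i * update c n Q i) + b n * update c n Q n ≡ t + Q * b n
      value′ = cong₂ _+_
        (trans (sumℕ-cong (suc j) (λ i 1≤i i≤j → cong (b i *_) (below i 1≤i i≤j))) value)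
        (trans (cong (b n *_) (update-same c n Q)) (*-comm (b n) Q))
      count′ : sumℕ (suc j) (update c n Q) + update c n Q n ≡ greedyCoins n (t + Q * b n)
      count′ = begin
        sumℕ (suc j) (update c n Q) + update c n Q n
          ≡⟨ cong₂ _+_ (trans (sumℕ-cong (suc j) below) count) (update-same c n Q) ⟩
        greedyCoins (suc j) t + Q ≡⟨ +-comm _ Q ⟩
        Q + greedyCoins (suc j) t ≡⟨ greedyCoins-step (suc j) Q t<b ⟨
        greedyCoins n (t + Q * b n) ∎
        where open ≡-Reasoning

  topCount : ℕ → ℕ
  topCount zero    = 0
  topCount (suc j) = s (suc j)

  greedyCoins-b∸1 : ∀ j {t} → suc t ≡ b (suc j) → greedyCoins j t ≡ topCount j
  greedyCoins-b∸1 zero    t+1≡1 = suc-injective t+1≡1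
  greedyCoins-b∸1 (suc j) {t} t+1≡b = trans (cong (greedyCoins (suc j)) t≡σB) (greedyCoins-*b j (s (suc j)))
    where
    t≡σB : t ≡ s (suc j) * b (suc j)
    t≡σB = suc-injective (trans t+1≡b (+-comm (s (suc j) * b (suc j)) 1))

  maxDrop : ℕ → ℕ
  maxDrop zero    = 0
  maxDrop (suc j) = topCount j ∸ 1

  module Monotone (n : ℕ) (s₁≥1 : 1 ≤ s 1) (mono : ∀ i → 1 ≤ i → suc i ≤ n → s i ≤ s (suc i)) where

    s≥1 : ∀ i → 1 ≤ i → i ≤ n → 1 ≤ s i
    s≥1 (suc zero)    _ _   = s₁≥1
    s≥1 (suc (suc i)) _ i<n = ≤-trans (s≥1 (suc i) (s≤s z≤n) (<⇒≤ i<n)) (mono (suc i) (s≤s z≤n) i<n)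

    j≤sum-s : ∀ j → j ≤ n → j ≤ sumℕ j s
    j≤sum-s zero    _   = z≤n
    j≤sum-s (suc j) j<n =
      subst (_≤ sumℕ j s + s (suc j)) (+-comm j 1)
            (+-mono-≤ (j≤sum-s j (<⇒≤ j<n)) (s≥1 (suc j) (s≤s z≤n) j<n))

    topCount≤s : ∀ j → suc j ≤ n → topCount j ≤ s (suc j)
    topCount≤s zero    _   = z≤n
    topCount≤s (suc j) j<n = mono (suc j) (s≤s z≤n) j<n

    maxDrop-mono : ∀ j → j ≤ n → maxDrop j ≤ maxDrop (suc j)
    maxDrop-mono zero    _   = z≤n
    maxDrop-mono (suc j) j<n = ∸-monoˡ-≤ 1 (topCount≤s j j<n)

    maxDrop<s : ∀ j → suc j ≤ n → maxDrop j < s (suc j)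
    maxDrop<s zero    _   = s₁≥1
    maxDrop<s (suc j) j<n =
      pred< (≤-trans (topCount≤s j (<⇒≤ j<n)) (mono (suc j) (s≤s z≤n) j<n))
            (s≥1 (suc (suc j)) (s≤s z≤n) j<n)
      where
      pred< : ∀ {t S} → t ≤ S → 0 < S → t ∸ 1 < S
      pred< {zero}  _   0<S = 0<S
      pred< {suc t} t<S _   = t<S

    greedyCoins-≤-suc : ∀ j → j ≤ suc n → ∀ r → greedyCoins j r ≤ greedyCoins j (suc r) + maxDrop j
    greedyCoins-≤-suc zero    _   r = ≤-trans (n≤1+n r) (m≤m+n (suc r) 0)
    greedyCoins-≤-suc (suc j) j<n = decompose j P step
      where
      B = b (suc j)
      P : ℕ → Set
      P r = greedyCoins (suc j) r ≤ greedyCoins (suc j) (suc r) + maxDrop (suc j)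
      open ≤-Reasoning
      step : ∀ t Q → t < B → P (t + Q * B)
      step t Q t<B with m≤n⇒m<n∨m≡n t<B
      ... | inj₁ t+1<B = begin
        greedyCoins (suc j) (t + Q * B)           ≡⟨ greedyCoins-step j Q t<B ⟩
        Q + greedyCoins j t                       ≤⟨ +-monoʳ-≤ Q (greedyCoins-≤-suc j (<⇒≤ j<n) t) ⟩
        Q + (greedyCoins j (suc t) + maxDrop j)   ≤⟨ +-monoʳ-≤ Q (+-monoʳ-≤ _ (maxDrop-mono j (ℕ.s≤s⁻¹ j<n))) ⟩
        Q + (greedyCoins j (suc t) + maxDrop (suc j)) ≡⟨ +-assoc Q _ _ ⟨
        Q + greedyCoins j (suc t) + maxDrop (suc j)   ≡⟨ cong (_+ maxDrop (suc j)) (greedyCoins-step j Q t+1<B) ⟨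
        greedyCoins (suc j) (suc t + Q * B) + maxDrop (suc j) ∎
      ... | inj₂ t+1≡B = begin
        greedyCoins (suc j) (t + Q * B)           ≡⟨ greedyCoins-step j Q t<B ⟩
        Q + greedyCoins j t                       ≡⟨ cong (_+_ Q) (greedyCoins-b∸1 j t+1≡B) ⟩
        Q + topCount j                            ≤⟨ +-monoʳ-≤ Q (m≤n+m∸n (topCount j) 1) ⟩
        Q + suc (maxDrop (suc j))                 ≡⟨ +-suc Q _ ⟩
        suc Q + maxDrop (suc j)                   ≡⟨ cong (_+ maxDrop (suc j)) (greedyCoins-*b j (suc Q)) ⟨
        greedyCoins (suc j) (suc Q * B) + maxDrop (suc j)
          ≡⟨ cong (λ v → greedyCoins (suc j) (v + Q * B) + maxDrop (suc j)) t+1≡B ⟨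
        greedyCoins (suc j) (suc t + Q * B) + maxDrop (suc j) ∎

    greedyCoins-+b : ∀ j → j ≤ n → ∀ M → suc (greedyCoins j M) ≤ greedyCoins j (M + b (suc j))
    greedyCoins-+b zero    _   M = ≤-reflexive (+-comm 1 M)
    greedyCoins-+b (suc j) j<n = decompose j P step
      where
      B = b (suc j)
      σ = s (suc j)
      P : ℕ → Set
      P M = suc (greedyCoins (suc j) M) ≤ greedyCoins (suc j) (M + (σ * B + 1))
      open ≤-Reasoning
      step : ∀ t Q → t < B → P (t + Q * B)
      step t Q t<B with m≤n⇒m<n∨m≡n t<B
      ... | inj₁ t+1<B = begin
        suc (greedyCoins (suc j) (t + Q * B))     ≡⟨ cong suc (greedyCoins-step j Q t<B) ⟩
        suc (Q + greedyCoins j t)                 ≤⟨ s≤s (+-monoʳ-≤ Q (greedyCoins-≤-suc j (m≤n⇒m≤1+n (<⇒≤ j<n)) t)) ⟩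
        suc (Q + (greedyCoins j (suc t) + maxDrop j)) ≡⟨ rearrange Q (greedyCoins j (suc t)) (maxDrop j) ⟩
        Q + greedyCoins j (suc t) + suc (maxDrop j)   ≤⟨ +-monoʳ-≤ _ (maxDrop<s j j<n) ⟩
        Q + greedyCoins j (suc t) + σ             ≡⟨ swap Q _ σ ⟩
        Q + σ + greedyCoins j (suc t)             ≡⟨ greedyCoins-step j (Q + σ) t+1<B ⟨
        greedyCoins (suc j) (suc t + (Q + σ) * B) ≡⟨ cong (greedyCoins (suc j)) (shift t Q σ B) ⟩
        greedyCoins (suc j) (t + Q * B + (σ * B + 1)) ∎
        where
        rearrange : ∀ Q g m → suc (Q + (g + m)) ≡ Q + g + suc m
        rearrange = solve-∀
        swap : ∀ Q g σ → Q + g + σ ≡ Q + σ + g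
        swap = solve-∀
        shift : ∀ t Q σ B → suc t + (Q + σ) * B ≡ t + Q * B + (σ * B + 1)
        shift = solve-∀
      ... | inj₂ t+1≡B = begin
        suc (greedyCoins (suc j) (t + Q * B))     ≡⟨ cong suc (greedyCoins-step j Q t<B) ⟩
        suc (Q + greedyCoins j t)                 ≡⟨ cong (λ g → suc (Q + g)) (greedyCoins-b∸1 j t+1≡B) ⟩
        suc (Q + topCount j)                      ≤⟨ s≤s (+-monoʳ-≤ Q (topCount≤s j j<n)) ⟩
        suc (Q + σ)                               ≡⟨ greedyCoins-*b j (suc (Q + σ)) ⟨
        greedyCoins (suc j) (suc (Q + σ) * B)     ≡⟨ cong (λ v → greedyCoins (suc j) (suc (Q + σ) * v)) t+1≡B ⟨
        greedyCoins (suc j) (suc (Q + σ) * suc t) ≡⟨ cong (greedyCoins (suc j)) (shift t Q σ) ⟩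
        greedyCoins (suc j) (t + Q * suc t + (σ * suc t + 1))
          ≡⟨ cong (λ v → greedyCoins (suc j) (t + Q * v + (σ * v + 1))) t+1≡B ⟩
        greedyCoins (suc j) (t + Q * B + (σ * B + 1)) ∎
        where
        shift : ∀ t Q σ → suc (Q + σ) * suc t ≡ t + Q * suc t + (σ * suc t + 1)
        shift = solve-∀

    greedyCoins-antitone : ∀ j → j ≤ n → ∀ N → greedyCoins (suc j) N ≤ greedyCoins j N
    greedyCoins-antitone j j≤n = decompose j _ step
      where
      B = b (suc j)
      Q+≤ : ∀ t Q → Q + greedyCoins j t ≤ greedyCoins j (t + Q * B)
      Q+≤ t zero    = ≤-reflexive (cong (greedyCoins j) (sym (+-identityʳ t)))
      Q+≤ t (suc Q) = ≤-trans (s≤s (Q+≤ t Q))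
        (≤-trans (greedyCoins-+b j j≤n (t + Q * B)) (≤-reflexive (cong (greedyCoins j) (shift t Q B))))
        where
        shift : ∀ t Q B → t + Q * B + B ≡ t + suc Q * B
        shift = solve-∀
      step : ∀ t Q → t < B → greedyCoins (suc j) (t + Q * B) ≤ greedyCoins j (t + Q * B)
      step t Q t<B = ≤-trans (≤-reflexive (greedyCoins-step j Q t<B)) (Q+≤ t Q)

    greedyCoins-optimal : ∀ j → j ≤ suc n → ∀ (c : ℕ → ℕ) →
                          greedyCoins j (sumℕ j (λ i → b i * c i)) ≤ sumℕ j c
    greedyCoins-optimal zero    _   c = z≤n
    greedyCoins-optimal (suc j) j<n c = begin
      greedyCoins (suc j) (V + b (suc j) * c (suc j)) ≡⟨ cong (λ v → greedyCoins (suc j) (V + v)) (*-comm (b (suc j)) _) ⟩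
      greedyCoins (suc j) (V + c (suc j) * b (suc j)) ≡⟨ greedyCoins-+* j V (c (suc j)) ⟩
      c (suc j) + greedyCoins (suc j) V ≤⟨ +-monoʳ-≤ (c (suc j)) (greedyCoins-antitone j (ℕ.s≤s⁻¹ j<n) V) ⟩
      c (suc j) + greedyCoins j V       ≤⟨ +-monoʳ-≤ (c (suc j)) (greedyCoins-optimal j (<⇒≤ j<n) c) ⟩
      c (suc j) + sumℕ j c              ≡⟨ +-comm (c (suc j)) _ ⟩
      sumℕ j c + c (suc j)              ∎
      where
      open ≤-Reasoning
      V = sumℕ j (λ i → b i * c i)

    greedyCoins-≤-+ : ∀ j → j ≤ suc n → ∀ t N → greedyCoins j N ≤ greedyCoins j (N + t) + t * maxDrop j
    greedyCoins-≤-+ j j≤n zero    N =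
      ≤-reflexive (sym (trans (+-identityʳ _) (cong (greedyCoins j) (+-identityʳ N))))
    greedyCoins-≤-+ j j≤n (suc t) N = begin
      greedyCoins j N                                       ≤⟨ greedyCoins-≤-+ j j≤n t N ⟩
      greedyCoins j (N + t) + t * δ                         ≤⟨ +-monoˡ-≤ _ (greedyCoins-≤-suc j j≤n (N + t)) ⟩
      greedyCoins j (suc (N + t)) + δ + t * δ               ≡⟨ +-assoc _ δ (t * δ) ⟩
      greedyCoins j (suc (N + t)) + suc t * δ               ≡⟨ cong (λ v → greedyCoins j v + suc t * δ) (+-suc N t) ⟨
      greedyCoins j (N + suc t) + suc t * δ                 ∎
      where
      open ≤-Reasoning
      δ = maxDrop j

    module Presentation {N : ℕ} {x : ℕ → ℕ} (isGreedy : IsGreedy (suc n) s N x) where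
      open IsGreedy isGreedy

      partialValue : ℕ → ℕ
      partialValue j = sumℕ j (λ i → b i * x i)

      below-saturated : ∀ j → suc j ≤ n → x (suc j) ≡ s (suc j) → ∀ l → 1 ≤ l → l ≤ j → x l ≡ 0
      below-saturated zero    _   _        l 1≤l l≤0 = ⊥-elim (1+n≰n (≤-trans 1≤l l≤0))
      below-saturated (suc j) j<n x≡s l 1≤l l≤j = greedy (suc (suc j)) (s≤s (s≤s z≤n)) j<n x≡s l 1≤l (s≤s l≤j)

      partialValue<b : ∀ j → j ≤ n → partialValue j < b (suc j)
      partialValue<b zero    _   = s≤s z≤n
      partialValue<b (suc j) j<n = ≤-<-trans value≤σB (m<m+n (σ * B) (s≤s z≤n))
        where
        B = b (suc j)
        σ = s (suc j)
        value≤σB : partialValue j + B * x (suc j) ≤ σ * B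
        value≤σB with m≤n⇒m<n∨m≡n (bounded (suc j) (s≤s z≤n) j<n)
        ... | inj₁ x<σ = <⇒≤ (begin-strict
          partialValue j + B * x (suc j) <⟨ +-monoˡ-< _ (partialValue<b j (<⇒≤ j<n)) ⟩
          B + B * x (suc j)              ≡⟨ *-suc B (x (suc j)) ⟨
          B * suc (x (suc j))            ≤⟨ *-monoʳ-≤ B x<σ ⟩
          B * σ                          ≡⟨ *-comm B σ ⟩
          σ * B                          ∎)
          where open ≤-Reasoning
        ... | inj₂ x≡σ = ≤-reflexive (begin
          partialValue j + B * x (suc j) ≡⟨ cong₂ _+_ lower-vanishes (cong (B *_) x≡σ) ⟩
          B * σ                          ≡⟨ *-comm B σ ⟩
          σ * B                          ∎)
          where
          open ≡-Reasoning
          lower-vanishes : partialValue j ≡ 0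
          lower-vanishes = sumℕ-zero j λ l 1≤l l≤j →
            trans (cong (b l *_) (below-saturated j j<n x≡σ l 1≤l l≤j)) (*-zeroʳ (b l))

      greedyCoins-partialValue : ∀ j → j ≤ suc n → greedyCoins j (partialValue j) ≡ sumℕ j x
      greedyCoins-partialValue zero    _   = refl
      greedyCoins-partialValue (suc j) j<n = begin
        greedyCoins (suc j) (V + B * x (suc j)) ≡⟨ cong (λ v → greedyCoins (suc j) (V + v)) (*-comm B _) ⟩
        greedyCoins (suc j) (V + x (suc j) * B) ≡⟨ greedyCoins-step j _ (partialValue<b j (ℕ.s≤s⁻¹ j<n)) ⟩
        x (suc j) + greedyCoins j V             ≡⟨ cong (_+_ (x (suc j))) (greedyCoins-partialValue j (<⇒≤ j<n)) ⟩
        x (suc j) + sumℕ j x                    ≡⟨ +-comm (x (suc j)) _ ⟩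
        sumℕ j x + x (suc j)                    ∎
        where
        open ≡-Reasoning
        B = b (suc j)
        V = partialValue j

      partialCount : ∀ j → j ≤ n → sumℕ j x + j ≤ sumℕ j s + 1
      partialCount zero    _   = z≤n
      partialCount (suc j) j<n with m≤n⇒m<n∨m≡n (bounded (suc j) (s≤s z≤n) j<n)
      ... | inj₁ x<σ = begin
        sumℕ j x + x (suc j) + suc j   ≡⟨ rearrange (sumℕ j x) (x (suc j)) j ⟩
        (sumℕ j x + j) + suc (x (suc j)) ≤⟨ +-mono-≤ (partialCount j (<⇒≤ j<n)) x<σ ⟩
        sumℕ j s + 1 + s (suc j)       ≡⟨ swap (sumℕ j s) 1 (s (suc j)) ⟩
        sumℕ j s + s (suc j) + 1       ∎
        where
        open ≤-Reasoning
        rearrange : ∀ a x j → a + x + suc j ≡ (a + j) + suc x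
        rearrange = solve-∀
        swap : ∀ a b c → a + b + c ≡ a + c + b
        swap = solve-∀
      ... | inj₂ x≡σ = begin
        sumℕ j x + x (suc j) + suc j   ≡⟨ cong₂ (λ u v → u + v + suc j) lower-vanishes x≡σ ⟩
        s (suc j) + suc j              ≡⟨ rearrange (s (suc j)) j ⟩
        j + s (suc j) + 1              ≤⟨ +-monoˡ-≤ 1 (+-monoˡ-≤ _ (j≤sum-s j (<⇒≤ j<n))) ⟩
        sumℕ j s + s (suc j) + 1       ∎
        where
        open ≤-Reasoning
        rearrange : ∀ σ j → σ + suc j ≡ j + σ + 1
        rearrange = solve-∀
        lower-vanishes : sumℕ j x ≡ 0
        lower-vanishes = sumℕ-zero j (below-saturated j j<n x≡σ)

      greedyCoins-presentation : greedyCoins (suc n) N ≡ sumℕ (suc n) x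
      greedyCoins-presentation =
        trans (cong (greedyCoins (suc n)) (sym total)) (greedyCoins-partialValue (suc n) ≤-refl)

module Semigroup (s : ℕ → ℕ) (n : ℕ) (s₁≥1 : 1 ≤ s 1) (mono : ∀ i → 1 ≤ i → suc i ≤ n → s i ≤ s (suc i))
                 (a u : ℕ) (d : ℤ) (C : ℕ) (C≡ua+d : + (u * a) ℤ.+ d ≡ + C) where
  open GreedyCoins s
  open Monotone n s₁≥1 mono

  k : ℕ
  k = suc n

  gen-suc : ∀ i → gen a u d s (suc i) ≡ + (a + b (suc i) * C)
  gen-suc i = begin
    + ((u * B + 1) * a) ℤ.+ d ℤ.* + B   ≡⟨ cong (λ v → + v ℤ.+ d ℤ.* + B) (expand u B a) ⟩
    + (B * (u * a) + a) ℤ.+ d ℤ.* + B   ≡⟨ cong (λ v → v ℤ.+ + a ℤ.+ d ℤ.* + B) (ℤ.pos-* B (u * a)) ⟩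
    + B ℤ.* + (u * a) ℤ.+ + a ℤ.+ d ℤ.* + B ≡⟨ collect (+ B) (+ (u * a)) (+ a) d ⟩
    + a ℤ.+ + B ℤ.* (+ (u * a) ℤ.+ d)   ≡⟨ cong (λ v → + a ℤ.+ + B ℤ.* v) C≡ua+d ⟩
    + a ℤ.+ + B ℤ.* + C                 ≡⟨ cong (ℤ._+_ (+ a)) (ℤ.pos-* B C) ⟨
    + (a + B * C)                       ∎
    where
    open ≡-Reasoning
    B = b (suc i)
    expand : ∀ u B a → (u * B + 1) * a ≡ B * (u * a) + a
    expand = solve-∀
    collect : ∀ B ua a d → B ℤ.* ua ℤ.+ a ℤ.+ d ℤ.* B ≡ a ℤ.+ B ℤ.* (ua ℤ.+ d)
    collect = ℤ-Solver.solve-∀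

  sumℤ-gen : ∀ j (c : ℕ → ℕ) →
             sumℤ j (λ i → + c i ℤ.* gen a u d s i) ≡ + (sumℕ j c * a + sumℕ j (λ i → b i * c i) * C)
  sumℤ-gen zero    c = refl
  sumℤ-gen (suc j) c = begin
    sumℤ j (λ i → + c i ℤ.* gen a u d s i) ℤ.+ + c (suc j) ℤ.* gen a u d s (suc j)
      ≡⟨ cong₂ ℤ._+_ (sumℤ-gen j c) (cong (ℤ._*_ (+ c (suc j))) (gen-suc j)) ⟩
    + (S * a + M * C) ℤ.+ + c (suc j) ℤ.* + (a + B * C)
      ≡⟨ cong (ℤ._+_ (+ (S * a + M * C))) (ℤ.pos-* (c (suc j)) _) ⟨
    + (S * a + M * C + c (suc j) * (a + B * C))
      ≡⟨ cong +_ (regroup S M (c (suc j)) a B C) ⟩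
    + ((S + c (suc j)) * a + (M + B * c (suc j)) * C) ∎
    where
    open ≡-Reasoning
    S = sumℕ j c
    M = sumℕ j (λ i → b i * c i)
    B = b (suc j)
    regroup : ∀ S M c a B C → S * a + M * C + c * (a + B * C) ≡ (S + c) * a + (M + B * c) * C
    regroup = solve-∀

  -- c₀ a + Σ c_i (a + b_i C) = (c₀ + Σ c_i) a + (Σ b_i c_i) C, and greedyCoins is optimal.
  Representable : ℕ → Set
  Representable N = ∃₂ λ m M → greedyCoins k M ≤ m × N ≡ m * a + M * C

  InSG⇒Representable : ∀ N → InSG a k u d s (+ N) → Representable N
  InSG⇒Representable N (c , N≡) =
    c 0 + sumℕ k c , sumℕ k (λ i → b i * c i) ,
    ≤-trans (greedyCoins-optimal k ≤-refl c) (m≤n+m _ (c 0)) ,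
    ℤ.+-injective (begin
      + N                                                    ≡⟨ N≡ ⟩
      + c 0 ℤ.* + a ℤ.+ sumℤ k (λ i → + c i ℤ.* gen a u d s i)
        ≡⟨ cong₂ ℤ._+_ (sym (ℤ.pos-* (c 0) a)) (sumℤ-gen k c) ⟩
      + (c 0 * a + (sumℕ k c * a + M * C))                   ≡⟨ cong +_ (regroup (c 0) a (sumℕ k c) M C) ⟩
      + ((c 0 + sumℕ k c) * a + M * C)                       ∎)
    where
    open ≡-Reasoning
    M = sumℕ k (λ i → b i * c i)
    regroup : ∀ c₀ a S M C → c₀ * a + (S * a + M * C) ≡ (c₀ + S) * a + M * C
    regroup = solve-∀

  Representable⇒InSG : ∀ N → Representable N → InSG a k u d s (+ N)
  Representable⇒InSG N (m , M , g≤m , N≡) with greedyCoins-attained k (s≤s z≤n) M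
  ... | c , value , count = c′ , (begin
    + N                                     ≡⟨ cong +_ (trans N≡ split) ⟩
    + ((m ∸ g) * a + (sumℕ k c′ * a + sumℕ k (λ i → b i * c′ i) * C))
      ≡⟨ cong₂ ℤ._+_ (ℤ.pos-* (m ∸ g) a) (sym (sumℤ-gen k c′)) ⟩
    + (m ∸ g) ℤ.* + a ℤ.+ sumℤ k (λ i → + c′ i ℤ.* gen a u d s i)
      ≡⟨ cong (λ v → + v ℤ.* + a ℤ.+ sumℤ k (λ i → + c′ i ℤ.* gen a u d s i)) (update-same c 0 (m ∸ g)) ⟨
    + c′ 0 ℤ.* + a ℤ.+ sumℤ k (λ i → + c′ i ℤ.* gen a u d s i) ∎)
    where
    open ≡-Reasoning
    g = greedyCoins k M
    c′ = update c 0 (m ∸ g)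
    c′≗c : ∀ i → 1 ≤ i → i ≤ k → c′ i ≡ c i
    c′≗c i 1≤i _ = update-other c 0 (m ∸ g) i (λ { refl → 1+n≰n 1≤i })
    split : m * a + M * C ≡ (m ∸ g) * a + (sumℕ k c′ * a + sumℕ k (λ i → b i * c′ i) * C)
    split = begin
      m * a + M * C                 ≡⟨ cong (λ v → v * a + M * C) (m∸n+n≡m g≤m) ⟨
      (m ∸ g + g) * a + M * C       ≡⟨ regroup (m ∸ g) g a M C ⟩
      (m ∸ g) * a + (g * a + M * C)
        ≡⟨ cong₂ (λ S V → (m ∸ g) * a + (S * a + V * C))
                 (sym (trans (sumℕ-cong k c′≗c) count))
                 (sym (trans (sumℕ-cong k (λ i 1≤i i≤k → cong (b i *_) (c′≗c i 1≤i i≤k))) value)) ⟩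
      (m ∸ g) * a + (sumℕ k c′ * a + sumℕ k (λ i → b i * c′ i) * C) ∎
      where
      regroup : ∀ r g a M C → (r + g) * a + M * C ≡ r * a + (g * a + M * C)
      regroup = solve-∀

frobeniusFormula : ℕ → (ℕ → ℕ) → ℕ → ℤ → ℤ
frobeniusFormula k x q C = sumℤ k (λ i → + (x i * q)) ℤ.+ (+ q ℤ.- + 1) ℤ.* C ℤ.- + q

module Frobenius (s : ℕ → ℕ) (n : ℕ) (s₁≥1 : 1 ≤ s 1) (mono : ∀ i → 1 ≤ i → suc i ≤ n → s i ≤ s (suc i))
                 (u : ℕ) (d : ℤ) (p q₁ : ℕ) .{{_ : NonZero p}} .{{_ : NonZero q₁}} (C : ℕ)
                 (C≡ua+d : + (u * (suc q₁ * p)) ℤ.+ d ≡ + C)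
                 (coprime : Coprime (suc q₁ * p) C)
                 {x : ℕ → ℕ} (isGreedy : IsGreedy (suc n) s (q₁ * p) x)
                 (count-bound : sumℕ n s + 1 ≤ C + n)
                 (drop-bound : suc q₁ * p * GreedyCoins.maxDrop s (suc n) ≤ C) where
  open GreedyCoins s
  open Monotone n s₁≥1 mono
  open Presentation isGreedy
  open IsGreedy isGreedy using (total; last)

  q = suc q₁
  a = q * p
  A′ = q₁ * p
  k = suc n

  instance
    a-nonZero : NonZero a
    a-nonZero = m*n≢0 q p

  open Semigroup s n s₁≥1 mono a u d C C≡ua+d using (Representable; InSG⇒Representable; Representable⇒InSG)

  G = sumℕ k x
  G₁ = ℕ.pred G

  G≡1+G₁ : G ≡ suc G₁
  G≡1+G₁ = sym (suc-pred G ⦃ ℕ.>-nonZero (n≢0⇒n>0 G≢0) ⦄)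
    where
    open ≡-Reasoning
    G≢0 : G ≢ 0
    G≢0 G≡0 = <⇒≢ (ℕ.>-nonZero⁻¹ A′ ⦃ m*n≢0 q₁ p ⦄) (begin
      0                        ≡⟨ sumℕ-zero k (λ i 1≤i i≤k →
                                    trans (cong (b i *_) (sumℕ≡0⇒≡0 k G≡0 i 1≤i i≤k)) (*-zeroʳ (b i))) ⟨
      sumℕ k (λ i → b i * x i) ≡⟨ total ⟩
      A′                       ∎)

  frobenius : ℕ
  frobenius = G₁ * q + q₁ * C

  p*frobenius : p * frobenius ≡ G₁ * a + A′ * C
  p*frobenius = distrib p G₁ q₁ C
    where
    distrib : ∀ p G₁ q₁ C → p * (G₁ * suc q₁ + q₁ * C) ≡ G₁ * (suc q₁ * p) + q₁ * p * C
    distrib = solve-∀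

  a≤gap : ∀ X Y e → X * a ≡ Y * a + suc e * C → a ≤ suc e
  a≤gap X Y e Xa≡Ya+eC = ∣⇒≤ (coprime-divisor coprime (subst (a ∣_) (*-comm (suc e) C) a∣eC))
    where
    a∣eC : a ∣ suc e * C
    a∣eC = ∣m+n∣m⇒∣n (subst (a ∣_) Xa≡Ya+eC (n∣m*n X)) (n∣m*n Y)

  cancel-gap : ∀ X Y M e → X + (M + e) * C ≡ Y + M * C → X + e * C ≡ Y
  cancel-gap X Y M e eq = +-cancelʳ-≡ (M * C) _ _ (trans (shuffle X M e C) eq)
    where
    shuffle : ∀ X M e C → X + e * C + M * C ≡ X + (M + e) * C
    shuffle = solve-∀

  G≤C+x : G ≤ C + x k
  G≤C+x = +-monoˡ-≤ (x k) (+-cancelʳ-≤ n (sumℕ n x) C (≤-trans (partialCount n ≤-refl) count-bound))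

  x≤greedyCoins : ∀ M → A′ ≤ M → x k ≤ greedyCoins k M
  x≤greedyCoins M A′≤M = begin
    x k                              ≡⟨ last ⟩
    (A′ / b k) ⦃ b-nonZero k ⦄        ≤⟨ /-monoˡ-≤ (b k) ⦃ b-nonZero k ⦄ A′≤M ⟩
    (M / b k) ⦃ b-nonZero k ⦄         ≤⟨ m≤m+n _ _ ⟩
    greedyCoins k M                  ∎
    where open ≤-Reasoning

  exact-not-representable : ∀ {m} → greedyCoins k A′ ≤ m → G₁ * a + A′ * C ≢ m * a + A′ * C
  exact-not-representable {m} coins≤m eq = 1+n≰n (begin
    suc m              ≡⟨ cong suc G₁≡m ⟨
    suc G₁             ≡⟨ G≡1+G₁ ⟨
    G                  ≡⟨ greedyCoins-presentation ⟨
    greedyCoins k A′   ≤⟨ coins≤m ⟩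
    m                  ∎)
    where
    open ≤-Reasoning
    G₁≡m : G₁ ≡ m
    G₁≡m = *-cancelʳ-≡ G₁ m a (+-cancelʳ-≡ (A′ * C) _ _ eq)

  underpaid-not-representable : ∀ {m M} e → M + suc e ≡ A′ → G₁ * a + A′ * C ≢ m * a + M * C
  underpaid-not-representable {m} {M} e M+e≡A′ eq =
    <⇒≱ A′<a (≤-trans (a≤gap m G₁ e (sym gap)) (≤-trans (m≤n+m (suc e) M) (≤-reflexive M+e≡A′)))
    where
    A′<a : A′ < a
    A′<a = +-monoˡ-< A′ (ℕ.>-nonZero⁻¹ p)
    gap : G₁ * a + suc e * C ≡ m * a
    gap = cancel-gap (G₁ * a) (m * a) M (suc e) (trans (cong (λ v → G₁ * a + v * C) M+e≡A′) eq)

  overpaid-not-representable : ∀ {m M} e → A′ + suc e ≡ M → greedyCoins k M ≤ m →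
                               G₁ * a + A′ * C ≢ m * a + M * C
  overpaid-not-representable {m} {M} e A′+e≡M coins≤m eq = 1+n≰n (begin
    suc (m + C)           ≤⟨ s≤s m+C≤G₁ ⟩
    suc G₁                ≡⟨ G≡1+G₁ ⟨
    G                     ≤⟨ G≤C+x ⟩
    C + x k               ≤⟨ +-monoʳ-≤ C (x≤greedyCoins M (subst (A′ ≤_) A′+e≡M (m≤m+n A′ (suc e)))) ⟩
    C + greedyCoins k M   ≤⟨ +-monoʳ-≤ C coins≤m ⟩
    C + m                 ≡⟨ +-comm C m ⟩
    m + C                 ∎)
    where
    open ≤-Reasoning
    gap : m * a + suc e * C ≡ G₁ * a
    gap = cancel-gap (m * a) (G₁ * a) A′ (suc e) (trans (cong (λ v → m * a + v * C) A′+e≡M) (sym eq))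
    m+C≤G₁ : m + C ≤ G₁
    m+C≤G₁ = *-cancelʳ-≤ (m + C) G₁ a (begin
      (m + C) * a         ≡⟨ *-distribʳ-+ a m C ⟩
      m * a + C * a       ≡⟨ cong (_+_ (m * a)) (*-comm C a) ⟩
      m * a + a * C       ≤⟨ +-monoʳ-≤ (m * a) (*-monoˡ-≤ C (a≤gap G₁ m e (sym gap))) ⟩
      m * a + suc e * C   ≡⟨ gap ⟩
      G₁ * a              ∎)

  frobenius-nonmember : ¬ Representable (p * frobenius)
  frobenius-nonmember (m , M , coins≤m , pF≡) with <-cmp M A′ | trans (sym p*frobenius) pF≡
  ... | tri< M<A′ _ _ | eq = let e , M+e≡A′ = m≤n⇒∃[o]m+o≡n M<A′ in
                             underpaid-not-representable {m} {M} e (trans (+-suc M e) M+e≡A′) eq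
  ... | tri≈ _ refl _ | eq = exact-not-representable {m} coins≤m eq
  ... | tri> _ _ A′<M | eq = let e , A′+e≡M = m≤n⇒∃[o]m+o≡n A′<M in
                             overpaid-not-representable {m} {M} e (trans (+-suc A′ e) A′+e≡M) coins≤m eq

  coprime-q : Coprime q C
  coprime-q (i∣q , i∣C) = coprime (∣-trans i∣q (m∣m*n p) , i∣C)

  G₁+j*p*maxDrop<m : ∀ {r m} j → r + j ≡ q₁ → frobenius < r * C + m * q → G₁ + j * (p * maxDrop k) < m
  G₁+j*p*maxDrop<m {r} {m} j r+j≡q₁ F<N = *-cancelʳ-< q _ m (begin-strict
    (G₁ + j * (p * δ)) * q    ≡⟨ distrib G₁ j p δ q ⟩
    G₁ * q + j * (q * p * δ)  ≤⟨ +-monoʳ-≤ (G₁ * q) (*-monoʳ-≤ j drop-bound) ⟩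
    G₁ * q + j * C            <⟨ +-cancelˡ-< (r * C) _ _ (begin-strict
      r * C + (G₁ * q + j * C)  ≡⟨ shuffle r C G₁ q j ⟩
      G₁ * q + (r + j) * C      ≡⟨ cong (λ v → G₁ * q + v * C) r+j≡q₁ ⟩
      frobenius                 <⟨ F<N ⟩
      r * C + m * q             ∎) ⟩
    m * q                     ∎)
    where
    open ≤-Reasoning
    δ = maxDrop k
    distrib : ∀ G₁ j p δ q → (G₁ + j * (p * δ)) * q ≡ G₁ * q + j * (q * p * δ)
    distrib = solve-∀
    shuffle : ∀ r C G₁ q j → r * C + (G₁ * q + j * C) ≡ G₁ * q + (r + j) * C
    shuffle = solve-∀

  greedyCoins-residue : ∀ {r m} → r ≤ q₁ → frobenius < r * C + m * q → greedyCoins k (p * r) ≤ m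
  greedyCoins-residue {r} {m} r≤q₁ F<N = begin
    greedyCoins k (p * r)                      ≤⟨ greedyCoins-≤-+ k ≤-refl (j * p) (p * r) ⟩
    greedyCoins k (p * r + j * p) + j * p * δ  ≡⟨ cong₂ (λ v w → greedyCoins k v + w) p*r+j*p≡A′ (*-assoc j p δ) ⟩
    greedyCoins k A′ + j * (p * δ)             ≡⟨ cong (_+ j * (p * δ)) (trans greedyCoins-presentation G≡1+G₁) ⟩
    suc (G₁ + j * (p * δ))                     ≤⟨ G₁+j*p*maxDrop<m j r+j≡q₁ F<N ⟩
    m                                          ∎
    where
    open ≤-Reasoning
    j = q₁ ∸ r
    δ = maxDrop k
    r+j≡q₁ : r + j ≡ q₁
    r+j≡q₁ = m+[n∸m]≡n r≤q₁
    p*r+j*p≡A′ : p * r + j * p ≡ A′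
    p*r+j*p≡A′ = trans (distrib p r j) (cong (_* p) r+j≡q₁)
      where
      distrib : ∀ p r j → p * r + j * p ≡ (r + j) * p
      distrib = solve-∀

  frobenius-member : ∀ N → frobenius < N → Representable (p * N)
  frobenius-member N F<N
    with coprime⇒decomposition coprime-q N (≤-trans (m≤n+m (q₁ * C) (G₁ * q)) (<⇒≤ F<N))
  ... | r , m , r≤q₁ , N≡rC+mq =
    m , p * r , greedyCoins-residue r≤q₁ (subst (frobenius <_) N≡rC+mq F<N) ,
    trans (cong (p *_) N≡rC+mq) (distrib p r C m q)
    where
    distrib : ∀ p r C m q → p * (r * C + m * q) ≡ m * (q * p) + p * r * C
    distrib = solve-∀

  frobenius-quotient : IsFrobenius (InQuot a k u d s p) (+ frobenius)
  frobenius-quotient = nonmember , member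
    where
    nonmember : ¬ InQuot a k u d s p (+ frobenius)
    nonmember (_ , _ , inSG) =
      frobenius-nonmember
        (InSG⇒Representable _ (subst (InSG a k u d s) (sym (ℤ.pos-* p frobenius)) inSG))
    member : ∀ z → + frobenius ℤ.< z → InQuot a k u d s p z
    member (+ N) (ℤ.+<+ F<N) =
      N , refl , subst (InSG a k u d s) (ℤ.pos-* p N) (Representable⇒InSG _ (frobenius-member N F<N))

  frobenius-formula : frobeniusFormula k x q (+ (u * a) ℤ.+ d) ≡ + frobenius
  frobenius-formula = begin
    sumℤ k (λ i → + (x i * q)) ℤ.+ (+ q ℤ.- + 1) ℤ.* (+ (u * a) ℤ.+ d) ℤ.- + q
      ≡⟨ cong₂ (λ v w → v ℤ.+ + q₁ ℤ.* w ℤ.- + q) sum≡ C≡ua+d ⟩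
    + q ℤ.+ + (G₁ * q) ℤ.+ + q₁ ℤ.* + C ℤ.- + q
      ≡⟨ cancel (+ q) (+ (G₁ * q)) (+ q₁ ℤ.* + C) ⟩
    + (G₁ * q) ℤ.+ + q₁ ℤ.* + C
      ≡⟨ cong (ℤ._+_ (+ (G₁ * q))) (ℤ.pos-* q₁ C) ⟨
    + frobenius ∎
    where
    open ≡-Reasoning
    sum≡ : sumℤ k (λ i → + (x i * q)) ≡ + q ℤ.+ + (G₁ * q)
    sum≡ = trans (sumℤ-+ k _) (cong +_ (trans (sumℕ-*ʳ k x q) (cong (_* q) G≡1+G₁)))
    cancel : ∀ Q X Y → Q ℤ.+ X ℤ.+ Y ℤ.- Q ≡ X ℤ.+ Y
    cancel = ℤ-Solver.solve-∀

S≤z+[1+n]-2⇒∃C : ∀ (z : ℤ) {S n} → n ≤ S → + S ℤ.≤ z ℤ.+ + suc n ℤ.- + 2 →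
                 ∃ λ C → z ≡ + C × S + 1 ≤ C + n
S≤z+[1+n]-2⇒∃C z {S} {n} n≤S S≤z+n-1 = ∣ w ∣ + 1 , z≡ , S+1≤
  where
  w = z ℤ.- + 1
  S≤w+n : + S ℤ.≤ w ℤ.+ + n
  S≤w+n = subst (+ S ℤ.≤_) (regroup z (+ n)) S≤z+n-1
    where
    regroup : ∀ z n → z ℤ.+ (+ 1 ℤ.+ n) ℤ.- + 2 ≡ z ℤ.- + 1 ℤ.+ n
    regroup = ℤ-Solver.solve-∀
  w≡+∣w∣ : + ∣ w ∣ ≡ w
  w≡+∣w∣ = ℤ.0≤i⇒+∣i∣≡i
    (subst (+ 0 ℤ.≤_) (cancel w (+ n)) (ℤ.i≤j⇒0≤j-i (ℤ.≤-trans (ℤ.+≤+ n≤S) S≤w+n)))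
    where
    cancel : ∀ w n → w ℤ.+ n ℤ.- n ≡ w
    cancel = ℤ-Solver.solve-∀
  z≡ : z ≡ + ∣ w ∣ ℤ.+ + 1
  z≡ = trans (shift z) (cong (ℤ._+ + 1) (sym w≡+∣w∣))
    where
    shift : ∀ z → z ≡ z ℤ.- + 1 ℤ.+ + 1
    shift = ℤ-Solver.solve-∀
  S+1≤ : S + 1 ≤ ∣ w ∣ + 1 + n
  S+1≤ = ≤-trans (+-monoˡ-≤ 1 (ℤ.drop‿+≤+ (subst (λ v → + S ℤ.≤ v ℤ.+ + n) (sym w≡+∣w∣) S≤w+n)))
                 (≤-reflexive (swap ∣ w ∣ n 1))
    where
    swap : ∀ a b c → a + b + c ≡ a + c + b
    swap = solve-∀

+A+-[1+D]≡+C⇒A≡C+1+D : ∀ {A D C} → + A ℤ.+ -[1+ D ] ≡ + C → A ≡ C + suc D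
+A+-[1+D]≡+C⇒A≡C+1+D {A} {D} eq =
  ℤ.+-injective (trans (cancel (+ A) -[1+ D ]) (cong (ℤ._- -[1+ D ]) eq))
  where
  cancel : ∀ i j → i ≡ i ℤ.+ j ℤ.- j
  cancel = ℤ-Solver.solve-∀

coprime-ua+d : ∀ {a u C} d → gcd a ℤ.∣ d ∣ ≡ 1 → + (u * a) ℤ.+ d ≡ + C → Coprime a C
coprime-ua+d {a} {u} (+ D)      gcd≡1 eq {i} (i∣a , i∣C) = gcd≡1⇒coprime gcd≡1
  (i∣a , ∣m+n∣m⇒∣n (subst (i ∣_) (sym (ℤ.+-injective eq)) i∣C) (∣-trans i∣a (n∣m*n u)))
coprime-ua+d {a} {u} -[1+ D ] gcd≡1 eq {i} (i∣a , i∣C) = gcd≡1⇒coprime gcd≡1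
  (i∣a , ∣m+n∣m⇒∣n (subst (i ∣_) (+A+-[1+D]≡+C⇒A≡C+1+D eq) (∣-trans i∣a (n∣m*n u))) i∣C)

ua≤C+a : ∀ a u {C} p .{{_ : NonZero p}} d → + a ℤ.+ + p ℤ.* d ℤ.≥ + 0 → + (u * a) ℤ.+ d ≡ + C →
         u * a ≤ C + a
ua≤C+a a u {C} p (+ D) _ eq =
  ≤-trans (m≤m+n (u * a) D) (≤-trans (≤-reflexive (ℤ.+-injective eq)) (m≤m+n C a))
ua≤C+a a u {C} p -[1+ D ] a+pd≥0 eq = begin
  u * a       ≡⟨ +A+-[1+D]≡+C⇒A≡C+1+D eq ⟩
  C + suc D   ≤⟨ +-monoʳ-≤ C (≤-trans (m≤n*m (suc D) p) pD≤a) ⟩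
  C + a       ∎
  where
  open ≤-Reasoning
  pD≤a : p * suc D ≤ a
  pD≤a = ℤ.drop‿+≤+ (ℤ.0≤i-j⇒j≤i (subst (λ v → + 0 ℤ.≤ + a ℤ.+ v) (ℤ.-◃n≡-n (p * suc D)) a+pd≥0))

ua≤C : ∀ a u {C} d → d ℤ.> + 0 → + (u * a) ℤ.+ d ≡ + C → u * a ≤ C
ua≤C a u (+ D) _ eq = ≤-trans (m≤m+n (u * a) D) (≤-reflexive (ℤ.+-injective eq))

a*t≤C+a⇒a*[t∸1]≤C : ∀ a t {C} → a * t ≤ C + a → a * (t ∸ 1) ≤ C
a*t≤C+a⇒a*[t∸1]≤C a t at≤C+a = begin
  a * (t ∸ 1)     ≡⟨ *-distribˡ-∸ a t 1 ⟩
  a * t ∸ a * 1   ≡⟨ cong (a * t ∸_) (*-identityʳ a) ⟩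
  a * t ∸ a       ≤⟨ m≤n+o⇒m∸n≤o (a * t) a (≤-trans at≤C+a (≤-reflexive (+-comm _ a))) ⟩
  _               ∎
  where open ≤-Reasoning

GCNS-frobenius : ∀ {a k d u s} → IsGCNS a k d u s → ∀ p .{{_ : NonZero p}} → p ∣ a → p ≢ a →
                 ∀ {x} → IsGreedy k s (a ∸ p) x →
                 + (u * a) ℤ.+ d ℤ.+ + k ℤ.- + 2 ℤ.≥ + sumℕ (k ∸ 1) s →
                 (∀ {C} → + (u * a) ℤ.+ d ≡ + C → a * s (k ∸ 1) ≤ C + a) →
                 IsFrobenius (InQuot a k u d s p) (frobeniusFormula k x (a / p) (+ (u * a) ℤ.+ d))
GCNS-frobenius {k = zero}        gcns = contradiction (IsGCNS.k≥2 gcns) λ ()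
GCNS-frobenius {k = suc zero}    gcns = contradiction (IsGCNS.k≥2 gcns) λ { (s≤s ()) }
GCNS-frobenius {k = suc (suc _)} gcns p (divides zero refl) = contradiction (IsGCNS.a≥2 gcns) λ ()
GCNS-frobenius {k = suc (suc _)} gcns p (divides (suc zero) refl) p≢p+0 =
  contradiction (sym (+-identityʳ p)) p≢p+0
GCNS-frobenius {a} {suc (suc n′)} {d} {u} {s} gcns p (divides (suc (suc q₂)) refl) _ {x} greedy H a*s≤C+a
  with S≤z+[1+n]-2⇒∃C _ (GreedyCoins.Monotone.j≤sum-s s _ (IsGCNS.s₁≥1 gcns) (IsGCNS.s-mono gcns) _ ≤-refl) H
... | C , C≡ua+d , count-bound =
  subst (IsFrobenius (InQuot a (suc n) u d s p)) (sym formula≡) F.frobenius-quotient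
  where
  n = suc n′
  q₁ = suc q₂
  module F = Frobenius s n (IsGCNS.s₁≥1 gcns) (IsGCNS.s-mono gcns) u d p q₁ C C≡ua+d
               (coprime-ua+d {u = u} d (IsGCNS.coprime gcns) C≡ua+d)
               (subst (λ N → IsGreedy (suc n) s N x) (m+n∸m≡n p (q₁ * p)) greedy)
               count-bound (a*t≤C+a⇒a*[t∸1]≤C a (s n) (a*s≤C+a C≡ua+d))
  formula≡ : frobeniusFormula (suc n) x (a / p) (+ (u * a) ℤ.+ d) ≡ + F.frobenius
  formula≡ = trans (cong (λ q → frobeniusFormula (suc n) x q (+ (u * a) ℤ.+ d)) (m*n/n≡m (suc q₁) p))
                   F.frobenius-formula

theorem3p2 : (a k : ℕ) (d : ℤ) (u : ℕ) (s : ℕ → ℕ) → IsGCNS a k d u s →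
  (p : ℕ) .⦃ _ : NonZero p ⦄ → p ∣ a → p ≢ a →
  (x : ℕ → ℕ) → IsGreedy k s (a ℕ.∸ p) x →
  ((+ (u ℕ.* a) ℤ.+ d ℤ.+ + k ℤ.- + 2 ℤ.≥ + sumℕ (k ℕ.∸ 1) s) →
   (+ a ℤ.+ + p ℤ.* d ℤ.≥ + 0) →
   (∀ i → 1 ℕ.≤ i → i ℕ.≤ k ℕ.∸ 1 → s i ℕ.< u ℕ.+ 1) →
   IsFrobenius (InQuot a k u d s p)
     (sumℤ k (λ i → + (x i ℕ.* (a ℕ./ p)))
       ℤ.+ (+ (a ℕ./ p) ℤ.- + 1) ℤ.* (+ (u ℕ.* a) ℤ.+ d) ℤ.- + (a ℕ./ p)))
  ×
  (d ℤ.> + 0 →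
   (+ (u ℕ.* a) ℤ.+ d ℤ.+ + k ℤ.- + 2 ℤ.≥ + sumℕ (k ℕ.∸ 1) s) →
   (∀ i → 1 ℕ.≤ i → i ℕ.≤ k ℕ.∸ 1 → s i ℕ.≤ u ℕ.+ 1) →
   IsFrobenius (InQuot a k u d s p)
     (sumℤ k (λ i → + (x i ℕ.* (a ℕ./ p)))
       ℤ.+ (+ (a ℕ./ p) ℤ.- + 1) ℤ.* (+ (u ℕ.* a) ℤ.+ d) ℤ.- + (a ℕ./ p)))
theorem3p2 a k d u s gcns p p∣a p≢a x greedy =
  (λ H a+pd≥0 s<u+1 → GCNS-frobenius gcns p p∣a p≢a greedy H (bound₁ a+pd≥0 (s<u+1 (k ∸ 1) last ≤-refl))) ,
  (λ d>0 H s≤u+1 → GCNS-frobenius gcns p p∣a p≢a greedy H (bound₂ d>0 (s≤u+1 (k ∸ 1) last ≤-refl)))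
  where
  open ≤-Reasoning
  last : 1 ≤ k ∸ 1
  last = ∸-monoˡ-≤ 1 (IsGCNS.k≥2 gcns)
  bound₁ : + a ℤ.+ + p ℤ.* d ℤ.≥ + 0 → s (k ∸ 1) < u + 1 →
           ∀ {C} → + (u * a) ℤ.+ d ≡ + C → a * s (k ∸ 1) ≤ C + a
  bound₁ a+pd≥0 s<u+1 C≡ua+d = begin
    a * s (k ∸ 1)   ≤⟨ *-monoʳ-≤ a (m<1+n⇒m≤n (subst (s (k ∸ 1) <_) (+-comm u 1) s<u+1)) ⟩
    a * u           ≡⟨ *-comm a u ⟩
    u * a           ≤⟨ ua≤C+a a u p d a+pd≥0 C≡ua+d ⟩
    _               ∎
  bound₂ : d ℤ.> + 0 → s (k ∸ 1) ≤ u + 1 →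
           ∀ {C} → + (u * a) ℤ.+ d ≡ + C → a * s (k ∸ 1) ≤ C + a
  bound₂ d>0 s≤u+1 {C} C≡ua+d = begin
    a * s (k ∸ 1)   ≤⟨ *-monoʳ-≤ a s≤u+1 ⟩
    a * (u + 1)     ≡⟨ *-distribˡ-+ a u 1 ⟩
    a * u + a * 1   ≡⟨ cong₂ _+_ (*-comm a u) (*-identityʳ a) ⟩
    u * a + a       ≤⟨ +-monoˡ-≤ a (ua≤C a u d d>0 C≡ua+d) ⟩
    C + a           ∎
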